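{- Let $G$ be the directed graph on vertex set $\{v_0,\dots,v_8,w_2,w_3,w_4\}$, where a vertex with index $i$ belongs to gender class $i \bmod 3$, and all indices of $v$ are taken modulo $9$. Its edges and ranks are: (1) $(v_i,v_{i+1})$ for $i=0,\dots,8$, of rank $1$; (2) $(w_i,v_{i-2})$ for $i=2,3,4$, of rank $1$; (3) $(v_i,w_{i+1})$ for $i=1,2,3$, of rank $2$; (4) $(v_i,v_{i+4})$ for $i=0,\dots,8$, of rank $2$ when $i\in\{0,4,5,6,7,8\}$ and of rank $3$ when $i\in\{1,2,3\}$. Then this instance of 3DSMI of dimension $4$ has no stable matching.
   Context: An instance of 3DSMI of dimension $n$ is a directed graph $G$ without multiple edges whose vertex set is partitioned into three gender classes of size $n$ each, cyclically ordered (men $\to$ women $\to$ dogs $\to$ men), with every edge going from a class to the next class in this cyclic order (here from class $i$ to class $i+1 \bmod 3$). Each edge $(v,v')$ carries a positive integer rank $r(v,v')$, and for every vertex $v$ of out-degree $k$ the ranks of edges leaving $v$ are exactly $1,\dots,k$. A family is a directed $3$-cycle of $G$. A matching $\mathcal M$ is a set of pairwise vertex-disjoint families. For a vertex $v$, $R_{\mathcal M}(v)$ is the rank of the edge leaving $v$ within its family in $\mathcal M$, and $R_{\mathcal M}(v)=+\infty$ if $v$ lies in no family of $\mathcal M$. A directed $3$-cycle $(v,v',v'')$ of $G$ is blocking for $\mathcal M$ if $r(v,v')<R_{\mathcal M}(v)$, $r(v',v'')<R_{\mathcal M}(v')$ and $r(v'',v)<R_{\mathcal M}(v'')$. A matching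 is stable if it has no blocking triple. -}

module Defs where

open import Data.Nat using (ℕ; zero; suc; _<_; _+_; _%_)
open import Data.Nat.Properties using () renaming (_≟_ to _≟ℕ_)
open import Data.Fin using (Fin; toℕ) renaming (_≟_ to _≟F_)
open import Data.Fin.Patterns
open import Data.Maybe using (Maybe; just; nothing)
open import Data.List using (List; []; _∷_)
open import Data.List.Membership.Propositional using (_∈_)
open import Data.List.Relation.Unary.AllPairs using (AllPairs)
open import Data.Product using (Σ; _×_)
open import Data.Empty using (⊥)
open import Relation.Nullary using (¬_; Dec; yes; no)
open import Relation.Binary.PropositionalEquality using (_≡_; refl; cong)

-- An instance is given by a partial rank function: rank x y ≡ just k
-- means (x,y) is an edge of rank k; nothing means no edge.

data ℕ∞ : Set where
  fin : ℕ → ℕ∞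
  ∞   : ℕ∞

data _<∞_ : ℕ∞ → ℕ∞ → Set where
  fin<fin : ∀ {m n} → m < n → fin m <∞ fin n
  fin<∞   : ∀ {m} → fin m <∞ ∞

module 3DSMI {V : Set} (_≟V_ : (x y : V) → Dec (x ≡ y))
             (rank : V → V → Maybe ℕ) where

  record Family : Set where
    constructor fam
    field
      a b c : V
      rab rbc rca : ℕ
      eab : rank a b ≡ just rab
      ebc : rank b c ≡ just rbc
      eca : rank c a ≡ just rca
  open Family public

  verts : Family → List V
  verts F = a F ∷ b F ∷ c F ∷ []

  Disjoint : Family → Family → Set
  Disjoint F F' = ∀ u → u ∈ verts F → u ∈ verts F' → ⊥

  record Matching : Set where
    field
      families : List Family
      disjoint : AllPairs Disjoint families
  open Matching public

  Rfam : List Family → V → ℕ∞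
  Rfam [] v = ∞
  Rfam (F ∷ M) v with v ≟V a F | v ≟V b F | v ≟V c F
  ... | yes _ | _     | _     = fin (rab F)
  ... | no _  | yes _ | _     = fin (rbc F)
  ... | no _  | no _  | yes _ = fin (rca F)
  ... | no _  | no _  | no _  = Rfam M v

  R : Matching → V → ℕ∞
  R M v = Rfam (families M) v

  Blocking : Matching → Family → Set
  Blocking M T = (fin (rab T) <∞ R M (a T))
               × (fin (rbc T) <∞ R M (b T))
               × (fin (rca T) <∞ R M (c T))

  Stable : Matching → Set
  Stable M = ∀ (T : Family) → ¬ Blocking M T

data Vtx : Set where
  v  : Fin 9 → Vtx
  w2 w3 w4 : Vtx

gender : Vtx → ℕ
gender (v i) = toℕ i % 3
gender w2 = 2
gender w3 = 0
gender w4 = 1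

v-inj : ∀ {i j} → v i ≡ v j → i ≡ j
v-inj refl = refl

_≟V_ : (x y : Vtx) → Dec (x ≡ y)
v i ≟V v j with i ≟F j
... | yes refl = yes refl
... | no ne = no (λ e → ne (v-inj e))
v _ ≟V w2 = no (λ ())
v _ ≟V w3 = no (λ ())
v _ ≟V w4 = no (λ ())
w2 ≟V v _ = no (λ ())
w2 ≟V w2 = yes refl
w2 ≟V w3 = no (λ ())
w2 ≟V w4 = no (λ ())
w3 ≟V v _ = no (λ ())
w3 ≟V w2 = no (λ ())
w3 ≟V w3 = yes refl
w3 ≟V w4 = no (λ ())
w4 ≟V v _ = no (λ ())
w4 ≟V w2 = no (λ ())
w4 ≟V w3 = no (λ ())
w4 ≟V w4 = yes refl

longRank : Fin 9 → ℕ
longRank 1F = 3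
longRank 2F = 3
longRank 3F = 3
longRank _  = 2

rankG : Vtx → Vtx → Maybe ℕ
rankG (v i) (v j) with toℕ j ≟ℕ ((toℕ i + 1) % 9) | toℕ j ≟ℕ ((toℕ i + 4) % 9)
... | yes _ | _     = just 1
... | no _  | yes _ = just (longRank i)
... | no _  | no _  = nothing
rankG w2 (v 0F) = just 1
rankG w3 (v 1F) = just 1
rankG w4 (v 2F) = just 1
rankG (v 1F) w2 = just 2
rankG (v 2F) w3 = just 2
rankG (v 3F) w4 = just 2
rankG _ _ = nothing

open 3DSMI _≟V_ rankG public

-- Every family of G is a rotation of one of the twelve directed 3-cycles listed in `cycles`.
-- For a matching M with rank profile ρ = R M, the profile is recovered from the set S of
-- cycles that agree with ρ: an unmatched vertex lies on no such cycle, and a matched vertex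
-- lies on (a rotation of) its own family. Hence ρ is the profile induced by a selection of
-- cycles that agrees with its own induced profile, and evaluating over all 2¹² selections
-- shows that every such selection is blocked by one of the twelve cycles.
module Submission where

open import Axiom.UniquenessOfIdentityProofs using (module Decidable⇒UIP)
open import Data.Bool using (T; true; false)
open import Data.Bool.Properties using (T?)
open import Data.Fin.Patterns
open import Data.Fin.Subset using (Subset; inside; outside)
open import Data.Fin.Subset.Properties using (anySubset?)
open import Data.List using (List; []; _∷_; map; filter; allFin)
open import Data.List.Membership.Propositional using (_∈_; _∉_; find; lose)
open import Data.List.Membership.Propositional.Properties using (∈-map⁺; ∈-allFin; ∈-filter⁺)
open import Data.List.Relation.Unary.All as All using (All; []; _∷_; all?)
open import Data.List.Relation.Unary.All.Properties using (all-filter)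
open import Data.List.Relation.Unary.AllPairs using (AllPairs; []; _∷_)
open import Data.List.Relation.Unary.Any as Any using (Any; here; there; any?; satisfied)
open import Data.Maybe using (Maybe; just; nothing; is-just)
import Data.Maybe.Properties as Maybe
open import Data.Maybe.Properties using (just-injective)
open import Data.Nat using (ℕ; _<?_)
open import Data.Nat.Properties using () renaming (_≟_ to _≟ℕ_)
open import Data.Product using (_×_; _,_; ∃-syntax; uncurry)
open import Data.Product.Properties using (≡-dec)
open import Data.Sum using (_⊎_; inj₁; inj₂; map₂)
open import Data.Vec using (Vec; []; _∷_; toList)
import Data.Vec as Vec
open import Function using (_∘_)
open import Relation.Binary using (DecidableEquality)
open import Relation.Binary.PropositionalEquality using (_≡_; _≢_; refl; sym; trans; subst; cong)
open import Relation.Nullary using (¬_; Dec; yes; no; does; ¬?; _×-dec_; _→-dec_; contradiction)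
open import Relation.Nullary.Decidable using (toWitness; toWitnessFalse; decidable-stable)
open import Relation.Unary using (Decidable)

open import Defs using (ℕ∞; fin; ∞; _<∞_; fin<fin; fin<∞; module 3DSMI)

fin-injective : ∀ {m n} → fin m ≡ fin n → m ≡ n
fin-injective refl = refl

_≟∞_ : DecidableEquality ℕ∞
fin m ≟∞ fin n with m ≟ℕ n
... | yes refl = yes refl
... | no m≢n = no (m≢n ∘ fin-injective)
fin _ ≟∞ ∞     = no λ ()
∞     ≟∞ fin _ = no λ ()
∞     ≟∞ ∞     = yes refl

_<∞?_ : (x y : ℕ∞) → Dec (x <∞ y)
fin m <∞? fin n with m <? n
... | yes m<n = yes (fin<fin m<n)
... | no m≮n = no λ { (fin<fin m<n) → m≮n m<n }
fin _ <∞? ∞ = yes fin<∞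
∞     <∞? _ = no λ ()

open Decidable⇒UIP (Maybe.≡-dec _≟ℕ_) using (≡-irrelevant)

module 3DSMI-Properties {V : Set} (_≟_ : DecidableEquality V) (rank : V → V → Maybe ℕ) where

  open 3DSMI _≟_ rank

  Profile : Set
  Profile = V → ℕ∞

  Agrees : Profile → Family → Set
  Agrees ρ F = ρ (a F) ≡ fin (rab F) × ρ (b F) ≡ fin (rbc F) × ρ (c F) ≡ fin (rca F)

  Blocks : Profile → Family → Set
  Blocks ρ T = fin (rab T) <∞ ρ (a T) × fin (rbc T) <∞ ρ (b T) × fin (rca T) <∞ ρ (c T)

  agrees? : (ρ : Profile) → Decidable (Agrees ρ)
  agrees? ρ F =
    (ρ (a F) ≟∞ fin (rab F)) ×-dec (ρ (b F) ≟∞ fin (rbc F)) ×-dec (ρ (c F) ≟∞ fin (rca F))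

  blocks? : (ρ : Profile) → Decidable (Blocks ρ)
  blocks? ρ T =
    (fin (rab T) <∞? ρ (a T)) ×-dec (fin (rbc T) <∞? ρ (b T)) ×-dec (fin (rca T) <∞? ρ (c T))

  Agrees-resp : ∀ {ρ σ} F → (∀ u → u ∈ verts F → ρ u ≡ σ u) → Agrees ρ F → Agrees σ F
  Agrees-resp F ρ≗σ (pa , pb , pc) =
    trans (sym (ρ≗σ _ (here refl))) pa ,
    trans (sym (ρ≗σ _ (there (here refl)))) pb ,
    trans (sym (ρ≗σ _ (there (there (here refl))))) pc

  Blocks-resp : ∀ {ρ σ} T → (∀ u → ρ u ≡ σ u) → Blocks ρ T → Blocks σ T
  Blocks-resp T ρ≗σ (pa , pb , pc) =
    subst (_ <∞_) (ρ≗σ (a T)) pa ,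
    subst (_ <∞_) (ρ≗σ (b T)) pb ,
    subst (_ <∞_) (ρ≗σ (c T)) pc

  corners : Family → V × V × V
  corners F = a F , b F , c F

  family-ext : ∀ {F G} → corners F ≡ corners G → F ≡ G
  family-ext {fam x y z _ _ _ p q r} {fam _ _ _ _ _ _ p′ q′ r′} refl
    with refl ← just-injective (trans (sym p) p′)
       | refl ← just-injective (trans (sym q) q′)
       | refl ← just-injective (trans (sym r) r′)
    with refl ← ≡-irrelevant p p′
       | refl ← ≡-irrelevant q q′
       | refl ← ≡-irrelevant r r′
    = refl

  rotate : Family → Family
  rotate F = fam (b F) (c F) (a F) (rbc F) (rca F) (rab F) (ebc F) (eca F) (eab F)

  rotations : Family → List Family
  rotations F = F ∷ rotate F ∷ rotate (rotate F) ∷ []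

  Covers : Profile → V → Family → Set
  Covers ρ u F = u ∈ verts F × Agrees ρ F

  Covers-rotate : ∀ {ρ u} F → Covers ρ u (rotate F) → Covers ρ u F
  Covers-rotate F (u∈F , pb , pc , pa) = rotate-∈ u∈F , pa , pb , pc
    where
    rotate-∈ : ∀ {u} → u ∈ verts (rotate F) → u ∈ verts F
    rotate-∈ (here e)                 = there (here e)
    rotate-∈ (there (here e))         = there (there (here e))
    rotate-∈ (there (there (here e))) = here e

  Covers-rotations : ∀ {ρ u F} G → F ∈ rotations G → Covers ρ u F → Covers ρ u G
  Covers-rotations     G (here refl)                 cov = cov
  Covers-rotations {ρ} G (there (here refl))         cov = Covers-rotate {ρ} G cov
  Covers-rotations {ρ} G (there (there (here refl))) cov =
    Covers-rotate {ρ} G (Covers-rotate {ρ} (rotate G) cov)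

  ∉-verts : ∀ {u} F → u ≢ a F → u ≢ b F → u ≢ c F → u ∉ verts F
  ∉-verts F u≢a u≢b u≢c (here u≡a)                 = u≢a u≡a
  ∉-verts F u≢a u≢b u≢c (there (here u≡b))         = u≢b u≡b
  ∉-verts F u≢a u≢b u≢c (there (there (here u≡c))) = u≢c u≡c

  Rfam-skip : ∀ F Fs {u} → u ∉ verts F → Rfam (F ∷ Fs) u ≡ Rfam Fs u
  Rfam-skip F Fs {u} u∉F with u ≟ a F | u ≟ b F | u ≟ c F
  ... | yes u≡a | _       | _       = contradiction (here u≡a) u∉F
  ... | no _    | yes u≡b | _       = contradiction (there (here u≡b)) u∉F
  ... | no _    | no _    | yes u≡c = contradiction (there (there (here u≡c))) u∉F
  ... | no _    | no _    | no _    = refl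

  Rfam-∞-or-member : ∀ Fs u → Rfam Fs u ≡ ∞ ⊎ ∃[ F ] F ∈ Fs × u ∈ verts F
  Rfam-∞-or-member [] u = inj₁ refl
  Rfam-∞-or-member (F ∷ Fs) u with u ≟ a F | u ≟ b F | u ≟ c F
  ... | yes u≡a | _       | _       = inj₂ (F , here refl , here u≡a)
  ... | no _    | yes u≡b | _       = inj₂ (F , here refl , there (here u≡b))
  ... | no _    | no _    | yes u≡c = inj₂ (F , here refl , there (there (here u≡c)))
  ... | no _    | no _    | no _    with Rfam-∞-or-member Fs u
  ...   | inj₁ unmatched          = inj₁ unmatched
  ...   | inj₂ (G , G∈Fs , u∈G)   = inj₂ (G , there G∈Fs , u∈G)

  Rfam-agreeing : ∀ {ρ u} Fs → All (Agrees ρ) Fs →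
                  ρ u ≡ ∞ ⊎ Any (λ F → u ∈ verts F) Fs → Rfam Fs u ≡ ρ u
  Rfam-agreeing [] [] (inj₁ unmatched) = sym unmatched
  Rfam-agreeing {u = u} (F ∷ Fs) ((pa , pb , pc) ∷ agree) covered
    with u ≟ a F | u ≟ b F | u ≟ c F
  ... | yes refl | _        | _        = sym pa
  ... | no _     | yes refl | _        = sym pb
  ... | no _     | no _     | yes refl = sym pc
  ... | no u≢a   | no u≢b   | no u≢c   =
    Rfam-agreeing Fs agree (map₂ (Any.tail (∉-verts F u≢a u≢b u≢c)) covered)

  module _ (loopless : ∀ x → rank x x ≡ nothing) where

    edge-irreflexive : ∀ {x y k} → rank x y ≡ just k → x ≢ y
    edge-irreflexive {x} e refl with () ← trans (sym (loopless x)) e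

    Rfam-head : ∀ F Fs → Agrees (Rfam (F ∷ Fs)) F
    Rfam-head F Fs = at-a , at-b , at-c
      where
      at-a : Rfam (F ∷ Fs) (a F) ≡ fin (rab F)
      at-a with a F ≟ a F
      ... | yes _   = refl
      ... | no a≢a  = contradiction refl a≢a

      at-b : Rfam (F ∷ Fs) (b F) ≡ fin (rbc F)
      at-b with b F ≟ a F | b F ≟ b F
      ... | yes b≡a | _      = contradiction (sym b≡a) (edge-irreflexive (eab F))
      ... | no _    | yes _  = refl
      ... | no _    | no b≢b = contradiction refl b≢b

      at-c : Rfam (F ∷ Fs) (c F) ≡ fin (rca F)
      at-c with c F ≟ a F | c F ≟ b F | c F ≟ c F
      ... | yes c≡a | _       | _      = contradiction c≡a (edge-irreflexive (eca F))
      ... | no _    | yes c≡b | _      = contradiction (sym c≡b) (edge-irreflexive (ebc F))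
      ... | no _    | no _    | yes _  = refl
      ... | no _    | no _    | no c≢c = contradiction refl c≢c

    Rfam-member : ∀ {Fs F} → AllPairs Disjoint Fs → F ∈ Fs → Agrees (Rfam Fs) F
    Rfam-member {F ∷ Fs} _ (here refl) = Rfam-head F Fs
    Rfam-member {F′ ∷ Fs} {F} (F′-disjoint ∷ disjoint) (there F∈Fs) =
      Agrees-resp F (λ u u∈F → sym (Rfam-skip F′ Fs λ u∈F′ → All.lookup F′-disjoint F∈Fs u u∈F′ u∈F))
        (Rfam-member disjoint F∈Fs)

    R-∞-or-covered : ∀ M u → R M u ≡ ∞ ⊎ ∃[ F ] Covers (R M) u F
    R-∞-or-covered M u with Rfam-∞-or-member (families M) u
    ... | inj₁ unmatched       = inj₁ unmatched
    ... | inj₂ (F , F∈M , u∈F) = inj₂ (F , u∈F , Rfam-member (disjoint M) F∈M)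

open import Defs
open 3DSMI-Properties _≟V_ rankG

rankG-loopless : ∀ x → rankG x x ≡ nothing
rankG-loopless (v 0F) = refl
rankG-loopless (v 1F) = refl
rankG-loopless (v 2F) = refl
rankG-loopless (v 3F) = refl
rankG-loopless (v 4F) = refl
rankG-loopless (v 5F) = refl
rankG-loopless (v 6F) = refl
rankG-loopless (v 7F) = refl
rankG-loopless (v 8F) = refl
rankG-loopless w2     = refl
rankG-loopless w3     = refl
rankG-loopless w4     = refl

allVtx : List Vtx
allVtx = w2 ∷ w3 ∷ w4 ∷ map v (allFin 9)

∈-allVtx : ∀ x → x ∈ allVtx
∈-allVtx (v i) = there (there (there (∈-map⁺ v (∈-allFin i))))
∈-allVtx w2    = here refl
∈-allVtx w3    = there (here refl)
∈-allVtx w4    = there (there (here refl))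

cycles : Vec Family 12
cycles =
  fam (v 0F) (v 1F) (v 5F) 1 3 2 refl refl refl ∷
  fam (v 0F) (v 1F) w2     1 2 1 refl refl refl ∷
  fam (v 0F) (v 4F) (v 5F) 2 1 2 refl refl refl ∷
  fam (v 0F) (v 4F) (v 8F) 2 2 1 refl refl refl ∷
  fam (v 1F) (v 2F) (v 6F) 1 3 2 refl refl refl ∷
  fam (v 1F) (v 2F) w3     1 2 1 refl refl refl ∷
  fam (v 1F) (v 5F) (v 6F) 3 1 2 refl refl refl ∷
  fam (v 2F) (v 3F) (v 7F) 1 3 2 refl refl refl ∷
  fam (v 2F) (v 3F) w4     1 2 1 refl refl refl ∷
  fam (v 2F) (v 6F) (v 7F) 3 1 2 refl refl refl ∷
  fam (v 3F) (v 4F) (v 8F) 1 2 2 refl refl refl ∷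
  fam (v 3F) (v 7F) (v 8F) 3 1 2 refl refl refl ∷ []

cycleList : List Family
cycleList = toList cycles

IsEdge : Vtx → Vtx → Set
IsEdge x y = T (is-just (rankG x y))

isEdge? : ∀ x y → Dec (IsEdge x y)
isEdge? x y = T? (is-just (rankG x y))

RotatedCycle : Vtx × Vtx × Vtx → Set
RotatedCycle t = Any (λ C → Any (λ D → corners D ≡ t) (rotations C)) cycleList

rotatedCycle? : ∀ t → Dec (RotatedCycle t)
rotatedCycle? t =
  any? (λ C → any? (λ D → ≡-dec _≟V_ (≡-dec _≟V_ _≟V_) (corners D) t) (rotations C)) cycleList

TriangleIsCycle : Vtx → Vtx → Vtx → Set
TriangleIsCycle x y z = IsEdge x y × IsEdge y z × IsEdge z x → RotatedCycle (x , y , z)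

triangles-are-cycles : All (λ x → All (λ y → All (TriangleIsCycle x y) allVtx) allVtx) allVtx
triangles-are-cycles =
  toWitness {a? = all? (λ x → all? (λ y → all? (triangle? x y) allVtx) allVtx) allVtx} _
  where
  triangle? : ∀ x y z → Dec (TriangleIsCycle x y z)
  triangle? x y z = (isEdge? x y ×-dec isEdge? y z ×-dec isEdge? z x) →-dec rotatedCycle? (x , y , z)

family-edges : (F : Family) → IsEdge (a F) (b F) × IsEdge (b F) (c F) × IsEdge (c F) (a F)
family-edges F = is-just-of (eab F) , is-just-of (ebc F) , is-just-of (eca F)
  where
  is-just-of : ∀ {m : Maybe ℕ} {k} → m ≡ just k → T (is-just m)
  is-just-of e = subst (T ∘ is-just) (sym e) _

family-classification : (F : Family) → Any (λ C → F ∈ rotations C) cycleList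
family-classification F =
  Any.map (Any.map (sym ∘ family-ext))
    (All.lookup (All.lookup (All.lookup triangles-are-cycles
      (∈-allVtx (a F))) (∈-allVtx (b F))) (∈-allVtx (c F)) (family-edges F))

AgreeingCyclesCover : Profile → Set
AgreeingCyclesCover ρ = ∀ u → ρ u ≡ ∞ ⊎ Any (λ C → u ∈ verts C) (filter (agrees? ρ) cycleList)

matching-profile-covered : (M : Matching) → AgreeingCyclesCover (R M)
matching-profile-covered M u = map₂ covering-cycle (R-∞-or-covered rankG-loopless M u)
  where
  covering-cycle : ∃[ F ] Covers (R M) u F → Any (λ C → u ∈ verts C) (filter (agrees? (R M)) cycleList)
  covering-cycle (F , covers) = via-classification (find (family-classification F))
    where
    -- Destructuring `find (family-classification F)` with `with` or `let` makes Agda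
    -- normalise the decision procedure behind `triangles-are-cycles`; a helper avoids it.
    via-classification : ∃[ C ] C ∈ cycleList × F ∈ rotations C →
                         Any (λ C → u ∈ verts C) (filter (agrees? (R M)) cycleList)
    via-classification (C , C∈cycles , F∈rotations) with Covers-rotations C F∈rotations covers
    ... | u∈C , agrees = lose (∈-filter⁺ (agrees? (R M)) C∈cycles agrees) u∈C

pick : ∀ {A : Set} {n} → Subset n → Vec A n → List A
pick []            []       = []
pick (inside ∷ S)  (x ∷ xs) = x ∷ pick S xs
pick (outside ∷ S) (x ∷ xs) = pick S xs

pick-does : ∀ {A : Set} {P : A → Set} {n} (P? : Decidable P) (xs : Vec A n) →
            pick (Vec.map (does ∘ P?) xs) xs ≡ filter P? (toList xs)
pick-does P? []       = refl
pick-does P? (x ∷ xs) with does (P? x)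
... | true  = cong (x ∷_) (pick-does P? xs)
... | false = pick-does P? xs

selected : Subset 12 → List Family
selected S = pick S cycles

SelfAgreeing : Subset 12 → Set
SelfAgreeing S = All (Agrees (Rfam (selected S))) (selected S)

Unblocked : Subset 12 → Set
Unblocked S = ¬ Any (Blocks (Rfam (selected S))) cycleList

unblocked? : ∀ S → Dec (Unblocked S)
unblocked? S = ¬? (any? (blocks? (Rfam (selected S))) cycleList)

no-self-agreeing-selection-unblocked : ¬ (∃[ S ] SelfAgreeing S × Unblocked S)
no-self-agreeing-selection-unblocked =
  toWitnessFalse {a? = anySubset? λ S →
    all? (agrees? (Rfam (selected S))) (selected S) ×-dec unblocked? S} _

self-agreeing-selection-blocked : ∀ S → SelfAgreeing S → Any (Blocks (Rfam (selected S))) cycleList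
self-agreeing-selection-blocked S agreeing =
  decidable-stable (any? (blocks? (Rfam (selected S))) cycleList) λ unblocked →
    no-self-agreeing-selection-unblocked (S , agreeing , unblocked)

covered-profile-blocked : (ρ : Profile) → AgreeingCyclesCover ρ → Any (Blocks ρ) cycleList
covered-profile-blocked ρ covered =
  Any.map (λ {T} → Blocks-resp T selection≗ρ)
    (self-agreeing-selection-blocked S
      (All.map (λ {F} → Agrees-resp F λ u _ → sym (selection≗ρ u)) agreeing))
  where
  S : Subset 12
  S = Vec.map (does ∘ agrees? ρ) cycles

  picked : selected S ≡ filter (agrees? ρ) cycleList
  picked = pick-does (agrees? ρ) cycles

  agreeing : All (Agrees ρ) (selected S)
  agreeing = subst (All (Agrees ρ)) (sym picked) (all-filter (agrees? ρ) cycleList)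

  selection≗ρ : ∀ u → Rfam (selected S) u ≡ ρ u
  selection≗ρ u = Rfam-agreeing _ agreeing (map₂ (subst (Any _) (sym picked)) (covered u))

theorem4 : (M : Matching) → ¬ Stable M
theorem4 M stable =
  uncurry stable (satisfied (covered-profile-blocked (R M) (matching-profile-covered M)))
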